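{- Let $\pi\in res_n(\tilde{\mathcal{A}})$ for some $n\ge1$, and let $t$ be the binary increasing tree with $n$ nodes such that $\psi(t)=\pi$. Then the set of right-to-left minima of $\pi$ is exactly the set of labels of the nodes on the max-path of $t$.
   Context: A binary increasing tree with $n$ nodes is a rooted tree (children unordered) in which every node has $0$, $1$ or $2$ children, whose nodes are labelled bijectively by $\{1,\dots,n\}$ so that labels strictly increase along every root-to-leaf path; it is strictly binary if no node has exactly one child. In the standard drawing, a node with two children has the smaller-labelled child on its left and the larger on its right, and a node with one child has it on its right; in the left-oriented drawing the same holds except that a node with one child has it on its left. $\phi(t)$ (resp. $\psi(t)$) is the permutation obtained by reading the labels of the standard (resp. left-oriented) drawing of $t$ in in-order (left subtree, node, right subtree). $\tilde{\mathcal{A}}$ is the set of all $\phi(t)$ with $t$ strictly binary increasing (any size). For $\pi\in\mathcal{S}_N$ and $1\le k\le N$, the restriction of $\pi$ to $\{1,\dots,k\}$ is obtained from $\pi_1\cdots\pi_N$ by deleting entries larger than $k$; write $\sigma\lhd\pi$. $res_n(\tilde{\mathcal{A}})=\{\sigma\in\mathcal{S}_n:\exists\,\pi\in\tilde{\mathcal{A}},\ \sigma\lhd\pi\}$. Every element of $res_n(\tilde{\mathcal{A}})$ equals $\psi(t)$ for a unique binary increasing tree $t$ with $n$ nodes. A right-to-left minimum of $\pi=\pi_1\cdots\pi_n$ is an entry $\pi_i$ with $\pi_i<\pi_j$ for all $j>i$. The max-path of a binary increasing tree is the sequence of nodes obtained by starting at the root and, as long as the current node has exactly two children, moving to the child with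 the larger label; the path stops at the first node that does not have two children. -}

module Defs where

open import Data.Nat using (ℕ; zero; suc; _<_; _≤_; _<ᵇ_; _≤?_)
open import Data.Bool using (if_then_else_)
open import Data.List using (List; []; _∷_; _++_; [_]; applyUpTo; filter)
open import Data.List.Relation.Unary.All using (All)
open import Data.List.Relation.Binary.Permutation.Propositional using (_↭_)
open import Data.Product using (Σ; ∃; _×_; _,_)
open import Data.Empty using (⊥)
open import Data.Unit using (⊤)
open import Relation.Binary.PropositionalEquality using (_≡_)

-- The two children of a binary node are stored in some order, but all
-- functions below treat them as an UNORDERED pair (they compare the root
-- labels to decide which child is drawn left / followed by the max-path).
data BT : Set where
  node0 : ℕ → BT
  node1 : ℕ → BT → BT
  node2 : ℕ → BT → BT → BT

root : BT → ℕ
root (node0 a)     = a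
root (node1 a _)   = a
root (node2 a _ _) = a

labels : BT → List ℕ
labels (node0 a)     = [ a ]
labels (node1 a c)   = a ∷ labels c
labels (node2 a l r) = a ∷ (labels l ++ labels r)

Increasing : BT → Set
Increasing (node0 a)     = ⊤
Increasing (node1 a c)   = (a < root c) × Increasing c
Increasing (node2 a l r) = (a < root l) × (a < root r) × Increasing l × Increasing r

range : ℕ → List ℕ
range n = applyUpTo suc n

IsBIT : ℕ → BT → Set
IsBIT n t = Increasing t × (labels t ↭ range n)

StrictlyBinary : BT → Set
StrictlyBinary (node0 a)     = ⊤
StrictlyBinary (node1 a c)   = ⊥
StrictlyBinary (node2 a l r) = StrictlyBinary l × StrictlyBinary r

-- standard drawing, in-order reading (single child on the right)
φ : BT → List ℕ
φ (node0 a)     = [ a ]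
φ (node1 a c)   = a ∷ φ c
φ (node2 a l r) = if root l <ᵇ root r then φ l ++ (a ∷ φ r) else φ r ++ (a ∷ φ l)

-- left-oriented drawing, in-order reading (single child on the left)
ψ : BT → List ℕ
ψ (node0 a)     = [ a ]
ψ (node1 a c)   = ψ c ++ [ a ]
ψ (node2 a l r) = if root l <ᵇ root r then ψ l ++ (a ∷ ψ r) else ψ r ++ (a ∷ ψ l)

InAtilde : ℕ → List ℕ → Set
InAtilde N π = Σ BT λ t → IsBIT N t × StrictlyBinary t × (φ t ≡ π)

restrict : ℕ → List ℕ → List ℕ
restrict k π = filter (_≤? k) π

InRes : ℕ → List ℕ → Set
InRes n σ = (σ ↭ range n) ×
  (Σ ℕ λ N → Σ (List ℕ) λ π → InAtilde N π × (1 ≤ n) × (n ≤ N) × (restrict n π ≡ σ))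

RLMin : List ℕ → ℕ → Set
RLMin π x = Σ (List ℕ) λ xs → Σ (List ℕ) λ ys → (π ≡ xs ++ (x ∷ ys)) × All (x <_) ys

maxPath : BT → List ℕ
maxPath (node0 a)     = [ a ]
maxPath (node1 a _)   = [ a ]
maxPath (node2 a l r) = a ∷ (if root l <ᵇ root r then maxPath r else maxPath l)

-- In the left-oriented drawing ψ reads a node a as  L ++ a ∷ R, where R is
-- the reading of the child with the larger label (empty if a has at most one
-- child).  Labels increase downwards, so a is below every entry of L and R:
-- a is a right-to-left minimum, no entry of L is one, and those of R are the
-- ones of that child.  Recursing into it follows exactly the max-path.
module Submission where

open import Defs
open import Data.Nat using (ℕ; _≤_; _<_; _<ᵇ_)
open import Data.Nat.Properties using (<-trans; <-asym)
open import Data.Bool using (true; false)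
open import Data.List using (List; []; _∷_; _++_)
open import Data.List.Properties using (∷-injectiveʳ)
open import Data.List.Membership.Propositional using (_∈_)
open import Data.List.Relation.Unary.All using (All; []; _∷_; lookup)
open import Data.List.Relation.Unary.All.Properties using (++⁺)
open import Data.List.Relation.Unary.Any using (here)
open import Data.List.Membership.Propositional.Properties using (∈-++⁺ʳ)
open import Data.List.Relation.Unary.Any.Properties using (∷↔)
open import Data.Product using (_×_; _,_)
open import Data.Sum using (_⊎_; inj₁; inj₂)
open import Data.Sum.Function.Propositional using (_⊎-⇔_)
open import Data.Empty using (⊥-elim)
open import Function.Bundles using (_⇔_; mk⇔; Equivalence)
open import Function.Properties.Equivalence using ()
  renaming (refl to ⇔-refl; trans to ⇔-trans)
open import Function.Properties.Inverse using (↔⇒⇔)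
open import Relation.Nullary using (¬_)
open import Relation.Binary.PropositionalEquality using (_≡_; refl)

RLMin-[] : ∀ {x} → ¬ RLMin [] x
RLMin-[] ([]    , _ , () , _)
RLMin-[] (_ ∷ _ , _ , () , _)

RLMin-∷ : ∀ {y ys x} → RLMin (y ∷ ys) x ⇔ ((x ≡ y × All (y <_) ys) ⊎ RLMin ys x)
RLMin-∷ {y} {ys} = mk⇔ to from
  where
  to : ∀ {x} → RLMin (y ∷ ys) x → (x ≡ y × All (y <_) ys) ⊎ RLMin ys x
  to ([]     , zs , refl , all) = inj₁ (refl , all)
  to (_ ∷ xs , zs , eq   , all) = inj₂ (xs , zs , ∷-injectiveʳ eq , all)

  from : ∀ {x} → (x ≡ y × All (y <_) ys) ⊎ RLMin ys x → RLMin (y ∷ ys) x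
  from (inj₁ (refl , all))          = [] , ys , refl , all
  from (inj₂ (xs , zs , refl , all)) = y ∷ xs , zs , refl , all

RLMin-++⁺ʳ : ∀ L {R x} → RLMin R x → RLMin (L ++ R) x
RLMin-++⁺ʳ []      m = m
RLMin-++⁺ʳ (l ∷ L) m = Equivalence.from RLMin-∷ (inj₂ (RLMin-++⁺ʳ L m))

-- An entry of L exceeds a ∈ R, which is read after it, so it is never a
-- right-to-left minimum of L ++ R.
RLMin-++⁻ʳ : ∀ {a L R x} → a ∈ R → All (a <_) L → RLMin (L ++ R) x → RLMin R x
RLMin-++⁻ʳ             a∈R []           m = m
RLMin-++⁻ʳ {L = _ ∷ L} a∈R (a<l ∷ a<L) m with Equivalence.to RLMin-∷ m
... | inj₁ (_ , l<L++R) = ⊥-elim (<-asym a<l (lookup l<L++R (∈-++⁺ʳ L a∈R)))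
... | inj₂ m′ = RLMin-++⁻ʳ a∈R a<L m′

RLMin-pivot : ∀ {a L R x} → All (a <_) L → All (a <_) R →
              RLMin (L ++ a ∷ R) x ⇔ (x ≡ a ⊎ RLMin R x)
RLMin-pivot {a} {L} {R} a<L a<R = mk⇔ to from
  where
  to : ∀ {x} → RLMin (L ++ a ∷ R) x → x ≡ a ⊎ RLMin R x
  to m with Equivalence.to RLMin-∷ (RLMin-++⁻ʳ (here refl) a<L m)
  ... | inj₁ (x≡a , _) = inj₁ x≡a
  ... | inj₂ m′        = inj₂ m′

  from : ∀ {x} → x ≡ a ⊎ RLMin R x → RLMin (L ++ a ∷ R) x
  from (inj₁ refl) = RLMin-++⁺ʳ L (Equivalence.from RLMin-∷ (inj₁ (refl , a<R)))
  from (inj₂ m)    = RLMin-++⁺ʳ L (Equivalence.from RLMin-∷ (inj₂ m))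

RLMin-pivot-∈ : ∀ {a L R M x} → All (a <_) L → All (a <_) R →
                (RLMin R x ⇔ x ∈ M) → RLMin (L ++ a ∷ R) x ⇔ x ∈ a ∷ M
RLMin-pivot-∈ a<L a<R R⇔M =
  ⇔-trans (RLMin-pivot a<L a<R) (⇔-trans (⇔-refl ⊎-⇔ R⇔M) (↔⇒⇔ (∷↔ _)))

RLMin-[]⇔∈[] : ∀ {x} → RLMin [] x ⇔ x ∈ []
RLMin-[]⇔∈[] = mk⇔ (λ m → ⊥-elim (RLMin-[] m)) (λ ())

All-<-ψ : ∀ {a} t → Increasing t → a < root t → All (a <_) (ψ t)
All-<-ψ (node0 b)     _                   a<b = a<b ∷ []
All-<-ψ (node1 b c)   (b<c , inc)         a<b = ++⁺ (All-<-ψ c inc (<-trans a<b b<c)) (a<b ∷ [])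
All-<-ψ (node2 b l r) (b<l , b<r , il , ir) a<b with root l <ᵇ root r
... | true  = ++⁺ (All-<-ψ l il (<-trans a<b b<l)) (a<b ∷ All-<-ψ r ir (<-trans a<b b<r))
... | false = ++⁺ (All-<-ψ r ir (<-trans a<b b<r)) (a<b ∷ All-<-ψ l il (<-trans a<b b<l))

RLMin-ψ⇔∈maxPath : ∀ t → Increasing t → (x : ℕ) → RLMin (ψ t) x ⇔ x ∈ maxPath t
RLMin-ψ⇔∈maxPath (node0 a)     _                   x = RLMin-pivot-∈ [] [] RLMin-[]⇔∈[]
RLMin-ψ⇔∈maxPath (node1 a c)   (a<c , ic)          x = RLMin-pivot-∈ (All-<-ψ c ic a<c) [] RLMin-[]⇔∈[]
RLMin-ψ⇔∈maxPath (node2 a l r) (a<l , a<r , il , ir) x with root l <ᵇ root r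
... | true  = RLMin-pivot-∈ (All-<-ψ l il a<l) (All-<-ψ r ir a<r) (RLMin-ψ⇔∈maxPath r ir x)
... | false = RLMin-pivot-∈ (All-<-ψ r ir a<r) (All-<-ψ l il a<l) (RLMin-ψ⇔∈maxPath l il x)

proposition3 : (n : ℕ) → 1 ≤ n → (π : List ℕ) → InRes n π →
    (t : BT) → IsBIT n t → ψ t ≡ π →
    (x : ℕ) → (RLMin π x ⇔ x ∈ maxPath t)
proposition3 n _ π _ t (increasing , _) refl = RLMin-ψ⇔∈maxPath t increasing
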